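{- Let $k\in\{1,2\}$, let $m,n\ge 2$, and let $A$ be an $m\times m$ ISDA matrix and $B$ an $n\times n$ ISDA matrix (both with parameter $k$). Let $C_A=n^{k}(A\otimes E_n)+(E_m\otimes B)$ and $C_D=(A\otimes E_n)+m^{k}(E_m\otimes B)$. Then $$\operatorname{rank}(C_A)=\operatorname{rank}(C_D)=\operatorname{rank}(A)+\operatorname{rank}(B)-1.$$
   Context: For an integer $N\ge2$ and $k\in\{1,2\}$, an $N\times N$ integer matrix $M$ is called ISDA (integer sequence doubly affine) with parameter $k$ if all its row sums and column sums are equal to a common value and: for $k=1$, every row and every column of $M$ contains each of $0,1,\dots,N-1$ exactly once (a Latin square); for $k=2$, the entries of $M$ are exactly $0,1,\dots,N^2-1$, each occurring once (semi-magic or magic square). $E_N$ denotes the $N\times N$ all-ones matrix and $\otimes$ the Kronecker product. -}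

module Defs where

open import Data.Nat using (ℕ; zero; suc; _*_; _^_)
open import Data.Integer using (ℤ; +_) renaming (_+_ to _+ℤ_; _*_ to _*ℤ_)
open import Data.Fin using (Fin; toℕ; quotient; remainder) renaming (zero to fzero; suc to fsuc)
open import Data.Product using (Σ; _×_; _,_; ∃)
open import Relation.Binary.PropositionalEquality using (_≡_)
open import Relation.Nullary using (¬_)
open import Data.Empty using (⊥)

Mat : ℕ → ℕ → Set
Mat r c = Fin r → Fin c → ℤ

∑ : (n : ℕ) → (Fin n → ℤ) → ℤ
∑ zero    f = + 0
∑ (suc n) f = f fzero +ℤ ∑ n (λ i → f (fsuc i))

EqualLineSums : (N : ℕ) → Mat N N → Set
EqualLineSums N M = Σ ℤ λ s → (∀ i → ∑ N (λ j → M i j) ≡ s) × (∀ j → ∑ N (λ i → M i j) ≡ s)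

ExactlyOnce : {X : Set} → (X → ℤ) → ℤ → Set
ExactlyOnce {X} f v = Σ X λ x → (f x ≡ v) × (∀ y → f y ≡ v → y ≡ x)

LatinRC : (N : ℕ) → Mat N N → Set
LatinRC N M = (∀ i (v : Fin N) → ExactlyOnce (λ j → M i j) (+ toℕ v))
            × (∀ j (v : Fin N) → ExactlyOnce (λ i → M i j) (+ toℕ v))

FullEntries : (N : ℕ) → Mat N N → Set
FullEntries N M = (∀ v → ExactlyOnce {Fin N × Fin N} (λ { (i , j) → M i j }) (+ toℕ {N * N} v))
                × (∀ i j → Σ (Fin (N * N)) λ v → M i j ≡ + toℕ v)

-- ISDA with parameter k (only k = 1, 2 are meaningful; other k: no matrix is ISDA)
ISDA : ℕ → (N : ℕ) → Mat N N → Set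
ISDA 1 N M = EqualLineSums N M × LatinRC N M
ISDA 2 N M = EqualLineSums N M × FullEntries N M
ISDA _ N M = ⊥

-- Kronecker product; row/column index of (A ⊗ B) is i*n + k ↔ (i , k)
_⊗_ : {m n : ℕ} → Mat m m → Mat n n → Mat (m * n) (m * n)
_⊗_ {m} {n} A B p q =
  A (quotient n p) (quotient n q) *ℤ B (remainder {m} n p) (remainder {m} n q)

E : (N : ℕ) → Mat N N
E N _ _ = + 1

_·_ : {r c : ℕ} → ℤ → Mat r c → Mat r c
(a · M) i j = a *ℤ M i j

_⊕_ : {r c : ℕ} → Mat r c → Mat r c → Mat r c
(M ⊕ M') i j = M i j +ℤ M' i j

-- linear independence of a family of integer vectors (over ℤ, equivalently over ℚ)
LinIndep : {r c : ℕ} → Mat r c → Set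
LinIndep {r} {c} V = ∀ (a : Fin r → ℤ) → (∀ j → ∑ r (λ t → a t *ℤ V t j) ≡ + 0) → ∀ t → a t ≡ + 0

HasRank : {r c : ℕ} → Mat r c → ℕ → Set
HasRank {r} {c} M ρ =
  (Σ (Fin ρ → Fin r) λ sel → LinIndep (λ t → M (sel t)))
  × (∀ (sel : Fin (suc ρ) → Fin r) → ¬ LinIndep (λ t → M (sel t)))

-- Write C = X (A ⊗ E) + Y (E ⊗ B) with X, Y > 0, so that row (i, j) of C is X times row i of A
-- plus Y times row j of B, both lifted to the product index set. Hence the rows of C lie in the
-- span of the lifted rows of rA independent rows of A and rB independent rows of B. Since A and
-- B have constant nonzero column sums, the all-ones vector lies in both lifted spans, which gives
-- a nontrivial relation among these rA + rB vectors, so rank C ≤ rA + rB − 1. Conversely, if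
-- a₀, …, a_{rA−1} and b₀, …, b_{rB−1} index independent rows, the rows (a_t, b₀), t ≥ 1, and
-- (a₀, b_s) of C are independent: a vanishing combination reads X u(i) + Y w(j) = 0 for a
-- combination u of rows of A and w of rows of B; summing over i and j, and using that a
-- combination of rows with constant positive row sums has entry sum proportional to the sum of
-- its coefficients, forces u = w = 0. Ranks are over ℚ; the arguments run over ℤ by clearing
-- denominators.

module Submission where

open import Defs

module LinearAlgebra where

  open import Data.Nat using (ℕ; zero; suc) renaming (_+_ to _+ℕ_)
  open import Data.Fin using (Fin; zero; suc; punchIn; _↑ˡ_; _↑ʳ_)
  open import Data.Fin.Properties using (all?; ¬∀⟶∃¬; sequence)
  open import Data.Vec.Functional using (_∷_; _++_; insertAt)
  open import Data.Vec.Functional.Properties using (lookup-++ˡ; lookup-++ʳ; insertAt-lookup; insertAt-punchIn)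
  open import Data.Integer using (ℤ; +_; 0ℤ; 1ℤ; _+_; _*_; -_; _≟_)
  open import Data.Integer.Properties
    using (+-*-semiring; +-identityˡ; +-identityʳ; +-assoc; *-assoc; *-comm; *-distribʳ-+; *-zeroˡ; *-zeroʳ; i*j≡0⇒i≡0∨j≡0)
  open import Data.Integer.Tactic.RingSolver using (solve-∀)
  import Algebra.Properties.Semiring.Sum +-*-semiring as Sum
  open import Data.Product using (Σ; _×_; _,_)
  open import Data.Sum using (inj₁; inj₂)
  open import Function using (_∘_)
  open import Relation.Nullary using (¬_; yes; no)
  open import Relation.Nullary.Decidable using (decidable-stable)
  open import Relation.Nullary.Negation using (contradiction; ¬¬-Monad; ¬¬-map)
  open import Effect.Monad using (RawMonad)
  open import Relation.Binary.PropositionalEquality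
  open ≡-Reasoning

  ∑≡sum : ∀ n (f : Fin n → ℤ) → ∑ n f ≡ Sum.sum f
  ∑≡sum zero    f = refl
  ∑≡sum (suc n) f = cong (_+_ (f zero)) (∑≡sum n (f ∘ suc))

  ∑-cong : ∀ n {f g : Fin n → ℤ} → f ≗ g → ∑ n f ≡ ∑ n g
  ∑-cong n {f} {g} f≗g = begin
    ∑ n f      ≡⟨ ∑≡sum n f ⟩
    Sum.sum f  ≡⟨ Sum.sum-cong-≗ f≗g ⟩
    Sum.sum g  ≡⟨ ∑≡sum n g ⟨
    ∑ n g      ∎

  ∑-zero : ∀ n {f : Fin n → ℤ} → (∀ i → f i ≡ 0ℤ) → ∑ n f ≡ 0ℤ
  ∑-zero n f≗0 = trans (∑-cong n f≗0) (trans (∑≡sum n (λ _ → 0ℤ)) (Sum.sum-replicate-zero n))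

  ∑-distrib-+ : ∀ n (f g : Fin n → ℤ) → ∑ n (λ i → f i + g i) ≡ ∑ n f + ∑ n g
  ∑-distrib-+ n f g = begin
    ∑ n (λ i → f i + g i)      ≡⟨ ∑≡sum n _ ⟩
    Sum.sum (λ i → f i + g i)  ≡⟨ Sum.∑-distrib-+ f g ⟩
    Sum.sum f + Sum.sum g      ≡⟨ cong₂ _+_ (∑≡sum n f) (∑≡sum n g) ⟨
    ∑ n f + ∑ n g              ∎

  *-distribˡ-∑ : ∀ n x (f : Fin n → ℤ) → x * ∑ n f ≡ ∑ n (λ i → x * f i)
  *-distribˡ-∑ n x f = begin
    x * ∑ n f                ≡⟨ cong (x *_) (∑≡sum n f) ⟩
    x * Sum.sum f            ≡⟨ Sum.*-distribˡ-sum x f ⟩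
    Sum.sum (λ i → x * f i)  ≡⟨ ∑≡sum n _ ⟨
    ∑ n (λ i → x * f i)      ∎

  *-distribʳ-∑ : ∀ n x (f : Fin n → ℤ) → ∑ n f * x ≡ ∑ n (λ i → f i * x)
  *-distribʳ-∑ n x f = begin
    ∑ n f * x                ≡⟨ cong (_* x) (∑≡sum n f) ⟩
    Sum.sum f * x            ≡⟨ Sum.*-distribʳ-sum x f ⟩
    Sum.sum (λ i → f i * x)  ≡⟨ ∑≡sum n _ ⟨
    ∑ n (λ i → f i * x)      ∎

  ∑-comm : ∀ a b (f : Fin a → Fin b → ℤ) → ∑ a (λ i → ∑ b (f i)) ≡ ∑ b (λ j → ∑ a (λ i → f i j))
  ∑-comm a b f = begin
    ∑ a (λ i → ∑ b (f i))                  ≡⟨ ∑-cong a (λ i → ∑≡sum b (f i)) ⟩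
    ∑ a (λ i → Sum.sum (f i))              ≡⟨ ∑≡sum a _ ⟩
    Sum.sum (λ i → Sum.sum (f i))          ≡⟨ Sum.∑-comm f ⟩
    Sum.sum (λ j → Sum.sum (λ i → f i j))  ≡⟨ ∑≡sum b _ ⟨
    ∑ b (λ j → Sum.sum (λ i → f i j))      ≡⟨ ∑-cong b (λ j → ∑≡sum a (λ i → f i j)) ⟨
    ∑ b (λ j → ∑ a (λ i → f i j))          ∎

  ∑-remove : ∀ n (t : Fin (suc n)) (f : Fin (suc n) → ℤ) → ∑ (suc n) f ≡ f t + ∑ n (f ∘ punchIn t)
  ∑-remove n t f = begin
    ∑ (suc n) f                    ≡⟨ ∑≡sum (suc n) f ⟩
    Sum.sum f                      ≡⟨ Sum.sum-remove {i = t} f ⟩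
    f t + Sum.sum (f ∘ punchIn t)  ≡⟨ cong (_+_ (f t)) (∑≡sum n _) ⟨
    f t + ∑ n (f ∘ punchIn t)      ∎

  ∑-const : ∀ n x → ∑ n (λ _ → x) ≡ + n * x
  ∑-const zero    x = sym (*-zeroˡ x)
  ∑-const (suc n) x = trans (cong (_+_ x) (∑-const n x)) (distrib x (+ n))
    where distrib : ∀ x n → x + n * x ≡ (1ℤ + n) * x
          distrib = solve-∀

  ∑-linear : ∀ r x y (f g : Fin r → ℤ) → ∑ r (λ t → x * f t + y * g t) ≡ x * ∑ r f + y * ∑ r g
  ∑-linear r x y f g = begin
    ∑ r (λ t → x * f t + y * g t)              ≡⟨ ∑-distrib-+ r _ _ ⟩
    ∑ r (λ t → x * f t) + ∑ r (λ t → y * g t)  ≡⟨ cong₂ _+_ (*-distribˡ-∑ r x f) (*-distribˡ-∑ r y g) ⟨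
    x * ∑ r f + y * ∑ r g                      ∎

  ∑-*-linear : ∀ {r} x y (a f g : Fin r → ℤ) →
    ∑ r (λ t → a t * (x * f t + y * g t)) ≡ x * ∑ r (λ t → a t * f t) + y * ∑ r (λ t → a t * g t)
  ∑-*-linear {r} x y a f g =
    trans (∑-cong r (λ t → distrib x y (a t) (f t) (g t))) (∑-linear r x y _ _)
    where distrib : ∀ x y a f g → a * (x * f + y * g) ≡ x * (a * f) + y * (a * g)
          distrib = solve-∀

  ∑-↑ : ∀ a b (f : Fin (a +ℕ b) → ℤ) → ∑ (a +ℕ b) f ≡ ∑ a (f ∘ (_↑ˡ b)) + ∑ b (f ∘ (a ↑ʳ_))
  ∑-↑ zero    b f = sym (+-identityˡ _)
  ∑-↑ (suc a) b f = trans (cong (_+_ (f zero)) (∑-↑ a b (f ∘ suc)))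
    (sym (+-assoc (f zero) (∑ a (f ∘ suc ∘ (_↑ˡ b))) (∑ b (f ∘ suc ∘ (a ↑ʳ_)))))

  ↑-elim : ∀ a {b} {P : Fin (a +ℕ b) → Set} → (∀ t → P (t ↑ˡ b)) → (∀ s → P (a ↑ʳ s)) → ∀ v → P v
  ↑-elim zero    left right v       = right v
  ↑-elim (suc a) left right zero    = left zero
  ↑-elim (suc a) left right (suc v) = ↑-elim a (left ∘ suc) right v

  lincomb : ∀ {r c} → (Fin r → ℤ) → Mat r c → Fin c → ℤ
  lincomb {r} a V j = ∑ r (λ t → a t * V t j)

  lincomb-*ˡ : ∀ {r c} x (a : Fin r → ℤ) (V : Mat r c) j → lincomb (λ t → x * a t) V j ≡ x * lincomb a V j
  lincomb-*ˡ {r} x a V j = begin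
    ∑ r (λ t → x * a t * V t j)    ≡⟨ ∑-cong r (λ t → *-assoc x (a t) (V t j)) ⟩
    ∑ r (λ t → x * (a t * V t j))  ≡⟨ *-distribˡ-∑ r x _ ⟨
    x * lincomb a V j              ∎

  lincomb-distrib-+ : ∀ {r c} (a b : Fin r → ℤ) (V : Mat r c) j →
    lincomb (λ t → a t + b t) V j ≡ lincomb a V j + lincomb b V j
  lincomb-distrib-+ {r} a b V j =
    trans (∑-cong r (λ t → *-distribʳ-+ (V t j) (a t) (b t))) (∑-distrib-+ r _ _)

  lincomb-const : ∀ {r c} (a : Fin r → ℤ) (v : Fin c → ℤ) j → lincomb a (λ _ → v) j ≡ ∑ r a * v j
  lincomb-const {r} a v j = sym (*-distribʳ-∑ r (v j) a)

  lincomb-assoc : ∀ {r d c} (a : Fin r → ℤ) (co : Mat r d) (W : Mat d c) j →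
    lincomb a (λ u → lincomb (co u) W) j ≡ lincomb (lincomb a co) W j
  lincomb-assoc {r} {d} a co W j = begin
    ∑ r (λ u → a u * ∑ d (λ s → co u s * W s j))    ≡⟨ ∑-cong r (λ u → *-distribˡ-∑ d (a u) _) ⟩
    ∑ r (λ u → ∑ d (λ s → a u * (co u s * W s j)))  ≡⟨ ∑-comm r d _ ⟩
    ∑ d (λ s → ∑ r (λ u → a u * (co u s * W s j)))  ≡⟨ ∑-cong d (λ s → ∑-cong r (λ u → sym (*-assoc (a u) (co u s) (W s j)))) ⟩
    ∑ d (λ s → ∑ r (λ u → a u * co u s * W s j))    ≡⟨ ∑-cong d (λ s → *-distribʳ-∑ r (W s j) _) ⟨
    ∑ d (λ s → lincomb a co s * W s j)              ∎

  lincomb-∘-++ : ∀ {a b c} {X : Set} (c′ : Fin (a +ℕ b) → ℤ) (M : X → Fin c → ℤ)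
    (f : Fin a → X) (g : Fin b → X) j →
    lincomb c′ (M ∘ (f ++ g)) j ≡ lincomb (c′ ∘ (_↑ˡ b)) (M ∘ f) j + lincomb (c′ ∘ (a ↑ʳ_)) (M ∘ g) j
  lincomb-∘-++ {a} {b} c′ M f g j = trans (∑-↑ a b _) (cong₂ _+_
    (∑-cong a (λ t → cong (λ x → c′ (t ↑ˡ b) * M x j) (lookup-++ˡ f g t)))
    (∑-cong b (λ s → cong (λ x → c′ (a ↑ʳ s) * M x j) (lookup-++ʳ f g s))))

  lincomb-++ : ∀ {a b c} (α : Fin a → ℤ) (β : Fin b → ℤ) (V : Mat a c) (W : Mat b c) j →
    lincomb (α ++ β) (V ++ W) j ≡ lincomb α V j + lincomb β W j
  lincomb-++ {a} {b} α β V W j = trans (lincomb-∘-++ (α ++ β) (λ v → v) V W j) (cong₂ _+_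
    (∑-cong a (λ t → cong (_* V t j) (lookup-++ˡ α β t)))
    (∑-cong b (λ s → cong (_* W s j) (lookup-++ʳ α β s))))

  lincomb-zeroˡ : ∀ {r c} (V : Mat r c) j → lincomb (λ _ → 0ℤ) V j ≡ 0ℤ
  lincomb-zeroˡ {r} V j = ∑-zero r (λ t → *-zeroˡ (V t j))

  ∑-lincomb : ∀ {r c} (a : Fin r → ℤ) (V : Mat r c) {s} → (∀ t → ∑ c (V t) ≡ s) → ∑ c (lincomb a V) ≡ ∑ r a * s
  ∑-lincomb {r} {c} a V {s} rowSums = begin
    ∑ c (λ j → ∑ r (λ t → a t * V t j))  ≡⟨ ∑-comm r c _ ⟨
    ∑ r (λ t → ∑ c (λ j → a t * V t j))  ≡⟨ ∑-cong r (λ t → trans (sym (*-distribˡ-∑ c (a t) (V t))) (cong (a t *_) (rowSums t))) ⟩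
    ∑ r (λ t → a t * s)                  ≡⟨ *-distribʳ-∑ r s a ⟨
    ∑ r a * s                            ∎

  *-cancelˡ-≡0 : ∀ {x y} → x ≢ 0ℤ → x * y ≡ 0ℤ → y ≡ 0ℤ
  *-cancelˡ-≡0 {x} x≢0 xy≡0 with i*j≡0⇒i≡0∨j≡0 x xy≡0
  ... | inj₁ x≡0 = contradiction x≡0 x≢0
  ... | inj₂ y≡0 = y≡0

  *-cancelʳ-≡0 : ∀ {x y} → y ≢ 0ℤ → x * y ≡ 0ℤ → x ≡ 0ℤ
  *-cancelʳ-≡0 {x} {y} y≢0 xy≡0 = *-cancelˡ-≡0 y≢0 (trans (*-comm y x) xy≡0)

  *-≢0 : ∀ {x y} → x ≢ 0ℤ → y ≢ 0ℤ → x * y ≢ 0ℤ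
  *-≢0 x≢0 y≢0 xy≡0 = y≢0 (*-cancelˡ-≡0 x≢0 xy≡0)

  Nontrivial : ∀ {r} → (Fin r → ℤ) → Set
  Nontrivial a = ¬ (∀ t → a t ≡ 0ℤ)

  Dependency : ∀ {r c} → Mat r c → Set
  Dependency {r} V = Σ (Fin r → ℤ) λ a → Nontrivial a × (∀ j → lincomb a V j ≡ 0ℤ)

  ¬LinIndep⇒¬¬Dependency : ∀ {r c} {V : Mat r c} → ¬ LinIndep V → ¬ ¬ Dependency V
  ¬LinIndep⇒¬¬Dependency ¬indep ¬dep = ¬indep λ a a-rel t →
    decidable-stable (a t ≟ 0ℤ) (λ at≢0 → ¬dep (a , (λ a≡0 → at≢0 (a≡0 t)) , a-rel))

  sumNonzero⇒LinIndep : ∀ {c} {v : Fin c → ℤ} → ∑ c v ≢ 0ℤ → LinIndep {1} (λ _ → v)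
  sumNonzero⇒LinIndep {c} {v} ∑v≢0 a a-rel zero = *-cancelʳ-≡0 ∑v≢0 (begin
    a zero * ∑ c v                ≡⟨ *-distribˡ-∑ c (a zero) v ⟩
    ∑ c (λ j → a zero * v j)      ≡⟨ ∑-zero c (λ j → trans (sym (+-identityʳ _)) (a-rel j)) ⟩
    0ℤ                            ∎)

  LinIndep-cong : ∀ {r c} {V V′ : Mat r c} → (∀ t j → V t j ≡ V′ t j) → LinIndep V → LinIndep V′
  LinIndep-cong {r} V≗V′ indep a a-rel = indep a (λ j → trans (∑-cong r (λ t → cong (a t *_) (V≗V′ t j))) (a-rel j))

  HasRank-cong : ∀ {r c} {M M′ : Mat r c} {ρ} → (∀ p q → M p q ≡ M′ p q) → HasRank M ρ → HasRank M′ ρ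
  HasRank-cong M≗M′ ((sel , indep) , maximal) =
    (sel , LinIndep-cong (λ t → M≗M′ (sel t)) indep) ,
    (λ sel′ → maximal sel′ ∘ LinIndep-cong (λ t j → sym (M≗M′ (sel′ t) j)))

  Dependency-zeroColumn : ∀ {r c} (M : Mat (suc r) (suc c)) → (∀ t → M t zero ≡ 0ℤ) →
    Dependency (λ t s → M (suc t) (suc s)) → Dependency M
  Dependency-zeroColumn {r} M col₀≡0 (a , a≢0 , a-rel) = 0ℤ ∷ a , (λ a≡0 → a≢0 (a≡0 ∘ suc)) , rel
    where
    rel : ∀ j → lincomb (0ℤ ∷ a) M j ≡ 0ℤ
    rel zero    = ∑-zero (suc r) {λ t → (0ℤ ∷ a) t * M t zero} λ
      { zero    → refl
      ; (suc t) → trans (cong (a t *_) (col₀≡0 (suc t))) (*-zeroʳ (a t)) }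
    rel (suc s) = trans (+-identityˡ _) (a-rel s)

  -- Fraction-free Gaussian elimination: scale the other rows by the pivot M t₀ zero and subtract
  -- multiples of the pivot row to clear column zero.
  eliminateColumn₀ : ∀ {r c} → Mat (suc r) (suc c) → Fin (suc r) → Mat r c
  eliminateColumn₀ M t₀ u s = M t₀ zero * M (punchIn t₀ u) (suc s) + - M t₀ (suc s) * M (punchIn t₀ u) zero

  Dependency-pivot : ∀ {r c} (M : Mat (suc r) (suc c)) (t₀ : Fin (suc r)) → M t₀ zero ≢ 0ℤ →
    Dependency (eliminateColumn₀ M t₀) → Dependency M
  Dependency-pivot {r} {c} M t₀ p≢0 (a , a≢0 , a-rel) = b , b≢0 , b-rel
    where
    p : ℤ
    p = M t₀ zero
    L : Fin (suc c) → ℤ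
    L = lincomb a (M ∘ punchIn t₀)
    b : Fin (suc r) → ℤ
    b = insertAt (λ u → p * a u) t₀ (- L zero)

    b≢0 : Nontrivial b
    b≢0 b≡0 = a≢0 λ u →
      *-cancelˡ-≡0 p≢0 (trans (sym (insertAt-punchIn (λ u → p * a u) t₀ (- L zero) u)) (b≡0 (punchIn t₀ u)))

    expand : ∀ j → lincomb b M j ≡ - L zero * M t₀ j + p * L j
    expand j = begin
      lincomb b M j                                                         ≡⟨ ∑-remove r t₀ (λ t → b t * M t j) ⟩
      b t₀ * M t₀ j + ∑ r (λ u → b (punchIn t₀ u) * M (punchIn t₀ u) j)  ≡⟨ cong₂ _+_
        (cong (_* M t₀ j) (insertAt-lookup (λ u → p * a u) t₀ (- L zero)))
        (trans (∑-cong r (λ u → cong (_* M (punchIn t₀ u) j) (insertAt-punchIn (λ u → p * a u) t₀ (- L zero) u))) (lincomb-*ˡ p a (M ∘ punchIn t₀) j)) ⟩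
      - L zero * M t₀ j + p * L j                                           ∎

    b-rel : ∀ j → lincomb b M j ≡ 0ℤ
    b-rel zero    = trans (expand zero) (cancel (L zero) p)
      where cancel : ∀ x p → - x * p + p * x ≡ 0ℤ
            cancel = solve-∀
    b-rel (suc s) = begin
      lincomb b M (suc s)                                 ≡⟨ expand (suc s) ⟩
      - L zero * M t₀ (suc s) + p * L (suc s)             ≡⟨ reorder (L zero) (M t₀ (suc s)) p (L (suc s)) ⟩
      p * L (suc s) + - M t₀ (suc s) * L zero             ≡⟨ ∑-*-linear p (- M t₀ (suc s)) a _ _ ⟨
      lincomb a (eliminateColumn₀ M t₀) s                 ≡⟨ a-rel s ⟩
      0ℤ                                                  ∎
      where reorder : ∀ x y p z → - x * y + p * z ≡ p * z + - y * x
            reorder = solve-∀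

  Dependency-tall : ∀ d (M : Mat (suc d) d) → Dependency M
  Dependency-tall zero    M = (λ _ → 1ℤ) , (λ 1≡0 → contradiction (1≡0 zero) λ ()) , λ ()
  Dependency-tall (suc d) M with all? (λ t → M t zero ≟ 0ℤ)
  ... | yes col₀≡0 = Dependency-zeroColumn M col₀≡0 (Dependency-tall d (λ t s → M (suc t) (suc s)))
  ... | no ¬col₀≡0 with ¬∀⟶∃¬ _ _ (λ t → M t zero ≟ 0ℤ) ¬col₀≡0
  ...   | t₀ , p≢0 = Dependency-pivot M t₀ p≢0 (Dependency-tall d (eliminateColumn₀ M t₀))

  -- v is a ℚ-linear combination of the rows of W, with the denominators cleared.
  record InSpan {D c} (W : Mat D c) (v : Fin c → ℤ) : Set where
    constructor inSpan
    field
      denominator   : ℤ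
      denominator≢0 : denominator ≢ 0ℤ
      coefficients  : Fin D → ℤ
      expansion     : ∀ q → denominator * v q ≡ lincomb coefficients W q

  InSpan-cong : ∀ {D c} {W : Mat D c} {v w} → (∀ q → v q ≡ w q) → InSpan W v → InSpan W w
  InSpan-cong v≗w (inSpan γ γ≢0 co e) = inSpan γ γ≢0 co (λ q → trans (cong (γ *_) (sym (v≗w q))) (e q))

  InSpan-∘ : ∀ {D c c′} {W : Mat D c} {v} (π : Fin c′ → Fin c) → InSpan W v → InSpan (λ s → W s ∘ π) (v ∘ π)
  InSpan-∘ π (inSpan γ γ≢0 co e) = inSpan γ γ≢0 co (e ∘ π)

  InSpan-0 : ∀ {D c} {W : Mat D c} → InSpan W (λ _ → 0ℤ)
  InSpan-0 {D} {W = W} = inSpan 1ℤ (λ ()) (λ _ → 0ℤ) (λ q → sym (∑-zero D (λ s → *-zeroˡ (W s q))))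

  InSpan-*ˡ : ∀ {D c} {W : Mat D c} {v} x → InSpan W v → InSpan W (λ q → x * v q)
  InSpan-*ˡ {W = W} {v} x (inSpan γ γ≢0 co e) = inSpan γ γ≢0 (λ s → x * co s) λ q → begin
    γ * (x * v q)              ≡⟨ swap γ x (v q) ⟩
    x * (γ * v q)              ≡⟨ cong (x *_) (e q) ⟩
    x * lincomb co W q         ≡⟨ lincomb-*ˡ x co W q ⟨
    lincomb (λ s → x * co s) W q  ∎
    where swap : ∀ γ x v → γ * (x * v) ≡ x * (γ * v)
          swap = solve-∀

  InSpan-+ : ∀ {D c} {W : Mat D c} {u w} → InSpan W u → InSpan W w → InSpan W (λ q → u q + w q)
  InSpan-+ {W = W} {u} {w} (inSpan γ₁ γ₁≢0 co₁ e₁) (inSpan γ₂ γ₂≢0 co₂ e₂) =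
    inSpan (γ₁ * γ₂) (*-≢0 γ₁≢0 γ₂≢0) (λ s → γ₂ * co₁ s + γ₁ * co₂ s) λ q → begin
      γ₁ * γ₂ * (u q + w q)                                    ≡⟨ distrib γ₁ γ₂ (u q) (w q) ⟩
      γ₂ * (γ₁ * u q) + γ₁ * (γ₂ * w q)                        ≡⟨ cong₂ (λ x y → γ₂ * x + γ₁ * y) (e₁ q) (e₂ q) ⟩
      γ₂ * lincomb co₁ W q + γ₁ * lincomb co₂ W q              ≡⟨ cong₂ _+_ (lincomb-*ˡ γ₂ co₁ W q) (lincomb-*ˡ γ₁ co₂ W q) ⟨
      lincomb (λ s → γ₂ * co₁ s) W q + lincomb (λ s → γ₁ * co₂ s) W q  ≡⟨ lincomb-distrib-+ (λ s → γ₂ * co₁ s) (λ s → γ₁ * co₂ s) W q ⟨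
      lincomb (λ s → γ₂ * co₁ s + γ₁ * co₂ s) W q              ∎
    where distrib : ∀ γ₁ γ₂ u w → γ₁ * γ₂ * (u + w) ≡ γ₂ * (γ₁ * u) + γ₁ * (γ₂ * w)
          distrib = solve-∀

  InSpan-∑ : ∀ {D c n} {W : Mat D c} {F : Fin n → Fin c → ℤ} → (∀ i → InSpan W (F i)) →
    InSpan W (λ q → ∑ n (λ i → F i q))
  InSpan-∑ {n = zero}  F⊆W = InSpan-0
  InSpan-∑ {n = suc n} F⊆W = InSpan-+ (F⊆W zero) (InSpan-∑ (F⊆W ∘ suc))

  InSpan-++ˡ : ∀ {D₁ D₂ c} {W₁ : Mat D₁ c} (W₂ : Mat D₂ c) {v} → InSpan W₁ v → InSpan (W₁ ++ W₂) v
  InSpan-++ˡ {W₁ = W₁} W₂ {v} (inSpan γ γ≢0 co e) = inSpan γ γ≢0 (co ++ λ _ → 0ℤ) λ q → begin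
    γ * v q                                                  ≡⟨ e q ⟩
    lincomb co W₁ q                                          ≡⟨ +-identityʳ _ ⟨
    lincomb co W₁ q + 0ℤ                                     ≡⟨ cong (_+_ (lincomb co W₁ q)) (lincomb-zeroˡ W₂ q) ⟨
    lincomb co W₁ q + lincomb (λ _ → 0ℤ) W₂ q                ≡⟨ lincomb-++ co _ W₁ W₂ q ⟨
    lincomb (co ++ λ _ → 0ℤ) (W₁ ++ W₂) q                    ∎

  InSpan-++ʳ : ∀ {D₁ D₂ c} (W₁ : Mat D₁ c) {W₂ : Mat D₂ c} {v} → InSpan W₂ v → InSpan (W₁ ++ W₂) v
  InSpan-++ʳ W₁ {W₂} {v} (inSpan γ γ≢0 co e) = inSpan γ γ≢0 ((λ _ → 0ℤ) ++ co) λ q → begin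
    γ * v q                                                  ≡⟨ e q ⟩
    lincomb co W₂ q                                          ≡⟨ +-identityˡ _ ⟨
    0ℤ + lincomb co W₂ q                                     ≡⟨ cong (_+ _) (lincomb-zeroˡ W₁ q) ⟨
    lincomb (λ _ → 0ℤ) W₁ q + lincomb co W₂ q                ≡⟨ lincomb-++ _ co W₁ W₂ q ⟨
    lincomb ((λ _ → 0ℤ) ++ co) (W₁ ++ W₂) q                  ∎

  InSpan-both⇒Dependency : ∀ {D₁ D₂ c} {W₁ : Mat D₁ c} {W₂ : Mat D₂ c} {v} →
    Nontrivial v → InSpan W₁ v → InSpan W₂ v → Dependency (W₁ ++ W₂)
  InSpan-both⇒Dependency {D₁} {D₂} {W₁ = W₁} {W₂} {v} v≢0 (inSpan γ₁ γ₁≢0 co₁ e₁) (inSpan γ₂ γ₂≢0 co₂ e₂) =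
    r₁ ++ r₂ , r≢0 , r-rel
    where
    r₁ : Fin D₁ → ℤ
    r₁ t = γ₂ * co₁ t
    r₂ : Fin D₂ → ℤ
    r₂ s = - γ₁ * co₂ s

    r-rel : ∀ q → lincomb (r₁ ++ r₂) (W₁ ++ W₂) q ≡ 0ℤ
    r-rel q = begin
      lincomb (r₁ ++ r₂) (W₁ ++ W₂) q                ≡⟨ lincomb-++ r₁ r₂ W₁ W₂ q ⟩
      lincomb r₁ W₁ q + lincomb r₂ W₂ q              ≡⟨ cong₂ _+_ (lincomb-*ˡ γ₂ co₁ W₁ q) (lincomb-*ˡ (- γ₁) co₂ W₂ q) ⟩
      γ₂ * lincomb co₁ W₁ q + - γ₁ * lincomb co₂ W₂ q  ≡⟨ cong₂ (λ x y → γ₂ * x + - γ₁ * y) (e₁ q) (e₂ q) ⟨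
      γ₂ * (γ₁ * v q) + - γ₁ * (γ₂ * v q)            ≡⟨ cancel γ₁ γ₂ (v q) ⟩
      0ℤ                                             ∎
      where cancel : ∀ γ₁ γ₂ x → γ₂ * (γ₁ * x) + - γ₁ * (γ₂ * x) ≡ 0ℤ
            cancel = solve-∀

    r≢0 : Nontrivial (r₁ ++ r₂)
    r≢0 r≡0 = v≢0 λ q → *-cancelˡ-≡0 γ₁≢0 (trans (e₁ q) (begin
      lincomb co₁ W₁ q               ≡⟨ ∑-cong D₁ (λ t → cong (_* W₁ t q) (co₁≡0 t)) ⟩
      lincomb (λ _ → 0ℤ) W₁ q        ≡⟨ lincomb-zeroˡ W₁ q ⟩
      0ℤ                             ∎))
      where co₁≡0 : ∀ t → co₁ t ≡ 0ℤ
            co₁≡0 t = *-cancelˡ-≡0 γ₂≢0 (trans (sym (lookup-++ˡ r₁ r₂ t)) (r≡0 (t ↑ˡ D₂)))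

  -- The relation r and the coordinate vectors of the V u are D + 1 vectors in ℤ^D; a dependency
  -- among them gives one among the V u, whose coefficients cannot all vanish since r ≢ 0.
  spannedByDependent⇒¬LinIndep : ∀ {D c} {W V : Mat D c} → Dependency W → (∀ u → InSpan W (V u)) → ¬ LinIndep V
  spannedByDependent⇒¬LinIndep {D} {c} {W} {V} (r , r≢0 , r-rel) V⊆W indep =
    no-coordinateDependency (Dependency-tall D (r ∷ co))
    where
    open InSpan
    γ : Fin D → ℤ
    γ u = denominator (V⊆W u)
    co : Mat D D
    co u = coefficients (V⊆W u)

    no-coordinateDependency : ¬ Dependency (r ∷ co)
    no-coordinateDependency (b , b≢0 , b-rel) = b≢0 b≡0
      where
      β : ℤ
      β = b zero
      a : Fin D → ℤ
      a = b ∘ suc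

      a·co-W≡0 : ∀ q → lincomb (lincomb a co) W q ≡ 0ℤ
      a·co-W≡0 q = begin
        lincomb (lincomb a co) W q                            ≡⟨ +-identityˡ _ ⟨
        0ℤ + lincomb (lincomb a co) W q                       ≡⟨ cong (_+ lincomb (lincomb a co) W q) β·r-W≡0 ⟨
        lincomb (λ s → β * r s) W q + lincomb (lincomb a co) W q  ≡⟨ lincomb-distrib-+ (λ s → β * r s) (lincomb a co) W q ⟨
        lincomb (λ s → β * r s + lincomb a co s) W q          ≡⟨ ∑-zero D (λ s → trans (cong (_* W s q) (b-rel s)) (*-zeroˡ (W s q))) ⟩
        0ℤ                                                    ∎
        where β·r-W≡0 : lincomb (λ s → β * r s) W q ≡ 0ℤ
              β·r-W≡0 = trans (lincomb-*ˡ β r W q) (trans (cong (β *_) (r-rel q)) (*-zeroʳ β))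

      aγ-rel : ∀ q → lincomb (λ u → a u * γ u) V q ≡ 0ℤ
      aγ-rel q = begin
        ∑ D (λ u → a u * γ u * V u q)         ≡⟨ ∑-cong D (λ u → trans (*-assoc (a u) (γ u) (V u q)) (cong (a u *_) (expansion (V⊆W u) q))) ⟩
        lincomb a (λ u → lincomb (co u) W) q  ≡⟨ lincomb-assoc a co W q ⟩
        lincomb (lincomb a co) W q            ≡⟨ a·co-W≡0 q ⟩
        0ℤ                                    ∎

      a≡0 : ∀ u → a u ≡ 0ℤ
      a≡0 u = *-cancelʳ-≡0 (denominator≢0 (V⊆W u)) (indep (λ u → a u * γ u) aγ-rel u)

      βr≡0 : ∀ s → β * r s ≡ 0ℤ
      βr≡0 s = begin
        β * r s                    ≡⟨ +-identityʳ _ ⟨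
        β * r s + 0ℤ               ≡⟨ cong (_+_ (β * r s)) (∑-zero D (λ u → trans (cong (_* co u s) (a≡0 u)) (*-zeroˡ (co u s)))) ⟨
        β * r s + lincomb a co s   ≡⟨ b-rel s ⟩
        0ℤ                         ∎

      b≡0 : ∀ t → b t ≡ 0ℤ
      b≡0 zero with β ≟ 0ℤ
      ... | yes β≡0 = β≡0
      ... | no  β≢0 = contradiction (λ s → *-cancelˡ-≡0 β≢0 (βr≡0 s)) r≢0
      b≡0 (suc u) = a≡0 u

  Dependency-∷⇒InSpan : ∀ {D c} {W : Mat D c} {v} → LinIndep W → Dependency (v ∷ W) → InSpan W v
  Dependency-∷⇒InSpan {W = W} {v} indep (b , b≢0 , b-rel) with b zero ≟ 0ℤ
  ... | yes b₀≡0 = contradiction b≡0 b≢0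
    where
    b≡0 : ∀ t → b t ≡ 0ℤ
    b≡0 zero    = b₀≡0
    b≡0 (suc t) = indep (b ∘ suc) (λ j → begin
      lincomb (b ∘ suc) W j                    ≡⟨ +-identityˡ _ ⟨
      0ℤ * v j + lincomb (b ∘ suc) W j         ≡⟨ cong (λ x → x * v j + lincomb (b ∘ suc) W j) b₀≡0 ⟨
      lincomb b (v ∷ W) j                      ≡⟨ b-rel j ⟩
      0ℤ                                       ∎) t
  ... | no  b₀≢0 = inSpan (b zero) b₀≢0 (λ t → - 1ℤ * b (suc t)) λ j → begin
    b zero * v j                                        ≡⟨ isolate (b zero * v j) (lincomb (b ∘ suc) W j) ⟩
    - 1ℤ * lincomb (b ∘ suc) W j + lincomb b (v ∷ W) j  ≡⟨ cong (_+_ (- 1ℤ * lincomb (b ∘ suc) W j)) (b-rel j) ⟩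
    - 1ℤ * lincomb (b ∘ suc) W j + 0ℤ                   ≡⟨ +-identityʳ _ ⟩
    - 1ℤ * lincomb (b ∘ suc) W j                        ≡⟨ lincomb-*ˡ (- 1ℤ) (b ∘ suc) W j ⟨
    lincomb (λ t → - 1ℤ * b (suc t)) W j                ∎
    where isolate : ∀ x y → x ≡ - 1ℤ * y + (x + y)
          isolate = solve-∀

  -- HasRank only says that no larger selection is independent, so the rows are spanned by a maximal
  -- independent selection only under double negation; this suffices for the negative upper bound.
  maximal⇒¬¬spanning : ∀ {r c ρ} {M : Mat r c} {sel : Fin ρ → Fin r} → LinIndep (M ∘ sel) →
    (∀ (sel′ : Fin (suc ρ) → Fin r) → ¬ LinIndep (M ∘ sel′)) → ¬ ¬ (∀ i → InSpan (M ∘ sel) (M i))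
  maximal⇒¬¬spanning {M = M} {sel} indep maximal = sequence (RawMonad.rawApplicative ¬¬-Monad) λ i →
    ¬¬-map (Dependency-∷⇒InSpan indep) (¬LinIndep⇒¬¬Dependency {V = M i ∷ M ∘ sel} (maximal (i ∷ sel)))

  LineSums : (N : ℕ) → Mat N N → ℤ → Set
  LineSums N M s = (∀ i → ∑ N (M i) ≡ s) × (∀ j → ∑ N (λ i → M i j) ≡ s)

open import Data.Nat using (ℕ; suc)
open import Data.Integer using (+[1+_])
open LinearAlgebra using (LineSums)

module KroneckerSumRank
  {m n : ℕ} (A : Mat (suc m) (suc m)) (B : Mat (suc n) (suc n))
  {sA sB : ℕ} (A-sums : LineSums (suc m) A +[1+ sA ]) (B-sums : LineSums (suc n) B +[1+ sB ])
  (x y : ℕ)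
  where

  open LinearAlgebra
  open import Data.Nat using (zero; _∸_) renaming (_+_ to _+ℕ_; _*_ to _*ℕ_)
  open import Data.Fin using (Fin; zero; suc; combine; quotient; remainder; _↑ˡ_; _↑ʳ_)
  open import Data.Fin.Properties using (remQuot-combine)
  open import Data.Vec.Functional using (_∷_; _++_)
  open import Data.Integer using (ℤ; +_; 0ℤ; _+_; _*_)
  open import Data.Integer.Properties using (*-assoc; *-comm; *-zeroʳ; +-identityˡ; +-comm)
  open import Data.Integer.Tactic.RingSolver using (solve-∀)
  open import Data.Product using (_×_; _,_; proj₁; proj₂)
  open import Data.Empty using (⊥-elim)
  open import Function using (_∘_; const)
  open import Relation.Nullary using (¬_)
  open import Relation.Nullary.Negation using (contradiction)
  open import Relation.Binary.PropositionalEquality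
  open ≡-Reasoning

  -- Weights and line sums are positive integers written +[1+ _ ], so that the nonvanishing of the
  -- products below holds by computation (λ ()).
  X Y SA SB : ℤ
  X  = +[1+ x ]
  Y  = +[1+ y ]
  SA = +[1+ sA ]
  SB = +[1+ sB ]

  quot : Fin (suc m *ℕ suc n) → Fin (suc m)
  quot = quotient (suc n)

  rem : Fin (suc m *ℕ suc n) → Fin (suc n)
  rem = remainder {suc m} (suc n)

  C : Mat (suc m *ℕ suc n) (suc m *ℕ suc n)
  C p q = X * A (quot p) (quot q) + Y * B (rem p) (rem q)

  C-combine : ∀ i j i′ j′ → C (combine i j) (combine i′ j′) ≡ X * A i i′ + Y * B j j′
  C-combine i j i′ j′ = cong₂ (λ p q → X * A (proj₁ p) (proj₁ q) + Y * B (proj₂ p) (proj₂ q))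
    (remQuot-combine i j) (remQuot-combine i′ j′)

  lincomb-C : ∀ {N} (c : Fin N → ℤ) (is : Fin N → Fin (suc m)) (js : Fin N → Fin (suc n)) i′ j′ →
    lincomb c (λ v → C (combine (is v) (js v))) (combine i′ j′)
      ≡ X * lincomb c (A ∘ is) i′ + Y * lincomb c (B ∘ js) j′
  lincomb-C {N} c is js i′ j′ =
    trans (∑-cong N (λ v → cong (c v *_) (C-combine (is v) (js v) i′ j′))) (∑-*-linear X Y c _ _)

  -- Summing over j gives (n+1) X u i + Y σ SB = 0, and summing that over i gives
  -- σ ((n+1) X SA + (m+1) Y SB) = 0; hence σ = 0, then u = 0 and finally w = 0.
  separable-vanishing : ∀ {σ} (u : Fin (suc m) → ℤ) (w : Fin (suc n) → ℤ) →
    (∀ i j → X * u i + Y * w j ≡ 0ℤ) → ∑ (suc m) u ≡ σ * SA → ∑ (suc n) w ≡ σ * SB →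
    (∀ i → u i ≡ 0ℤ) × (∀ j → w j ≡ 0ℤ)
  separable-vanishing {σ} u w uw≡0 ∑u ∑w = u≡0 , w≡0
    where
    row : ∀ i → + suc n * X * u i + Y * (σ * SB) ≡ 0ℤ
    row i = begin
      + suc n * X * u i + Y * (σ * SB)                        ≡⟨ cong₂ _+_ (*-assoc (+ suc n) X (u i)) (cong (Y *_) (sym ∑w)) ⟩
      + suc n * (X * u i) + Y * ∑ (suc n) w                   ≡⟨ cong₂ _+_ (sym (∑-const (suc n) (X * u i))) (*-distribˡ-∑ (suc n) Y w) ⟩
      ∑ (suc n) (λ _ → X * u i) + ∑ (suc n) (λ j → Y * w j)  ≡⟨ ∑-distrib-+ (suc n) (λ _ → X * u i) (λ j → Y * w j) ⟨
      ∑ (suc n) (λ j → X * u i + Y * w j)                     ≡⟨ ∑-zero (suc n) (uw≡0 i) ⟩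
      0ℤ                                                      ∎

    total : σ * (+ suc n * X * SA + + suc m * Y * SB) ≡ 0ℤ
    total = begin
      σ * (+ suc n * X * SA + + suc m * Y * SB)                        ≡⟨ expand σ (+ suc n * X) SA (+ suc m) Y SB ⟩
      + suc n * X * (σ * SA) + + suc m * (Y * (σ * SB))                ≡⟨ cong₂ _+_ (cong (+ suc n * X *_) ∑u) (∑-const (suc m) (Y * (σ * SB))) ⟨
      + suc n * X * ∑ (suc m) u + ∑ (suc m) (λ _ → Y * (σ * SB))       ≡⟨ cong (_+ ∑ (suc m) (λ _ → Y * (σ * SB))) (*-distribˡ-∑ (suc m) (+ suc n * X) u) ⟩
      ∑ (suc m) (λ i → + suc n * X * u i) + ∑ (suc m) (λ _ → Y * (σ * SB))  ≡⟨ ∑-distrib-+ (suc m) (λ i → + suc n * X * u i) (λ _ → Y * (σ * SB)) ⟨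
      ∑ (suc m) (λ i → + suc n * X * u i + Y * (σ * SB))               ≡⟨ ∑-zero (suc m) row ⟩
      0ℤ                                                               ∎
      where expand : ∀ σ a s m y t → σ * (a * s + m * y * t) ≡ a * (σ * s) + m * (y * (σ * t))
            expand = solve-∀

    σ≡0 : σ ≡ 0ℤ
    σ≡0 = *-cancelʳ-≡0 (λ ()) total

    u≡0 : ∀ i → u i ≡ 0ℤ
    u≡0 i = *-cancelˡ-≡0 {x = + suc n * X} (λ ()) (begin
      + suc n * X * u i                       ≡⟨ vanish (+ suc n * X * u i) Y SB ⟨
      + suc n * X * u i + Y * (0ℤ * SB)       ≡⟨ cong (λ s → + suc n * X * u i + Y * (s * SB)) σ≡0 ⟨
      + suc n * X * u i + Y * (σ * SB)        ≡⟨ row i ⟩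
      0ℤ                                      ∎)
      where vanish : ∀ a y s → a + y * (0ℤ * s) ≡ a
            vanish = solve-∀

    w≡0 : ∀ j → w j ≡ 0ℤ
    w≡0 j = *-cancelˡ-≡0 {x = Y} (λ ()) (begin
      Y * w j                ≡⟨ +-identityˡ _ ⟨
      0ℤ + Y * w j           ≡⟨ cong (_+ Y * w j) (trans (cong (X *_) (u≡0 zero)) (*-zeroʳ X)) ⟨
      X * u zero + Y * w j   ≡⟨ uw≡0 zero j ⟩
      0ℤ                     ∎)

  module Selection {a b} (selA : Fin (suc a) → Fin (suc m)) (selB : Fin (suc b) → Fin (suc n)) where

    rowsA : Fin (a +ℕ suc b) → Fin (suc m)
    rowsA = (selA ∘ suc) ++ const (selA zero)

    rowsB : Fin (a +ℕ suc b) → Fin (suc n)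
    rowsB = const (selB zero) ++ selB

    rows : Fin (a +ℕ suc b) → Fin (suc m *ℕ suc n)
    rows v = combine (rowsA v) (rowsB v)

    rows-LinIndep : LinIndep (A ∘ selA) → LinIndep (B ∘ selB) → LinIndep (C ∘ rows)
    rows-LinIndep indA indB c c-rel = ↑-elim a c₁≡0 c₂≡0
      where
      c₁ : Fin a → ℤ
      c₁ = c ∘ (_↑ˡ suc b)
      c₂ : Fin (suc b) → ℤ
      c₂ = c ∘ (a ↑ʳ_)

      u : Fin (suc m) → ℤ
      u = lincomb c (A ∘ rowsA)
      w : Fin (suc n) → ℤ
      w = lincomb c (B ∘ rowsB)

      uw≡0 : (∀ i → u i ≡ 0ℤ) × (∀ j → w j ≡ 0ℤ)
      uw≡0 = separable-vanishing {σ = ∑ (a +ℕ suc b) c} u w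
        (λ i j → trans (sym (lincomb-C c rowsA rowsB i j)) (c-rel (combine i j)))
        (∑-lincomb c (A ∘ rowsA) (proj₁ A-sums ∘ rowsA))
        (∑-lincomb c (B ∘ rowsB) (proj₁ B-sums ∘ rowsB))

      u-regrouped : ∀ i → u i ≡ lincomb (∑ (suc b) c₂ ∷ c₁) (A ∘ selA) i
      u-regrouped i = begin
        u i                                                          ≡⟨ lincomb-∘-++ c A (selA ∘ suc) (const (selA zero)) i ⟩
        lincomb c₁ (A ∘ selA ∘ suc) i + lincomb c₂ (const (A (selA zero))) i  ≡⟨ cong (_+_ (lincomb c₁ (A ∘ selA ∘ suc) i)) (lincomb-const c₂ (A (selA zero)) i) ⟩
        lincomb c₁ (A ∘ selA ∘ suc) i + ∑ (suc b) c₂ * A (selA zero) i  ≡⟨ +-comm (lincomb c₁ (A ∘ selA ∘ suc) i) (∑ (suc b) c₂ * A (selA zero) i) ⟩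
        lincomb (∑ (suc b) c₂ ∷ c₁) (A ∘ selA) i                     ∎

      w-regrouped : ∀ j → w j ≡ lincomb ((∑ a c₁ + c₂ zero) ∷ c₂ ∘ suc) (B ∘ selB) j
      w-regrouped j = begin
        w j                                                          ≡⟨ lincomb-∘-++ c B (const (selB zero)) selB j ⟩
        lincomb c₁ (const (B (selB zero))) j + lincomb c₂ (B ∘ selB) j  ≡⟨ cong (_+ lincomb c₂ (B ∘ selB) j) (lincomb-const c₁ (B (selB zero)) j) ⟩
        ∑ a c₁ * B (selB zero) j + lincomb c₂ (B ∘ selB) j           ≡⟨ merge (∑ a c₁) (c₂ zero) (B (selB zero) j) (lincomb (c₂ ∘ suc) (B ∘ selB ∘ suc) j) ⟩
        lincomb ((∑ a c₁ + c₂ zero) ∷ c₂ ∘ suc) (B ∘ selB) j         ∎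
        where merge : ∀ s c v l → s * v + (c * v + l) ≡ (s + c) * v + l
              merge = solve-∀

      coefficientsA≡0 : ∀ t → (∑ (suc b) c₂ ∷ c₁) t ≡ 0ℤ
      coefficientsA≡0 = indA _ (λ i → trans (sym (u-regrouped i)) (proj₁ uw≡0 i))

      coefficientsB≡0 : ∀ s → ((∑ a c₁ + c₂ zero) ∷ c₂ ∘ suc) s ≡ 0ℤ
      coefficientsB≡0 = indB _ (λ j → trans (sym (w-regrouped j)) (proj₂ uw≡0 j))

      c₁≡0 : ∀ t → c₁ t ≡ 0ℤ
      c₁≡0 = coefficientsA≡0 ∘ suc

      c₂≡0 : ∀ s → c₂ s ≡ 0ℤ
      c₂≡0 zero    = begin
        c₂ zero                    ≡⟨ +-identityˡ _ ⟨
        0ℤ + c₂ zero               ≡⟨ cong (_+ c₂ zero) (∑-zero a c₁≡0) ⟨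
        ∑ a c₁ + c₂ zero           ≡⟨ coefficientsB≡0 zero ⟩
        0ℤ                         ∎
      c₂≡0 (suc s) = coefficientsB≡0 (suc s)

  liftRows : ∀ {D k} → (Fin (suc m *ℕ suc n) → Fin k) → Mat D k → Mat D (suc m *ℕ suc n)
  liftRows π W s = W s ∘ π

  C-row-InSpan : ∀ {a b} {WA : Mat a (suc m)} {WB : Mat b (suc n)} →
    (∀ i → InSpan WA (A i)) → (∀ j → InSpan WB (B j)) → ∀ p → InSpan (liftRows quot WA ++ liftRows rem WB) (C p)
  C-row-InSpan A⊆WA B⊆WB p = InSpan-+
    (InSpan-++ˡ _ (InSpan-*ˡ X (InSpan-∘ quot (A⊆WA (quot p)))))
    (InSpan-++ʳ _ (InSpan-*ˡ Y (InSpan-∘ rem (B⊆WB (rem p)))))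

  liftedBases-Dependency : ∀ {a b} {WA : Mat a (suc m)} {WB : Mat b (suc n)} →
    (∀ i → InSpan WA (A i)) → (∀ j → InSpan WB (B j)) → Dependency (liftRows quot WA ++ liftRows rem WB)
  liftedBases-Dependency A⊆WA B⊆WB = InSpan-both⇒Dependency (λ v≡0 → contradiction (v≡0 zero) λ ())
    (InSpan-*ˡ SB (InSpan-∘ quot (InSpan-cong (proj₂ A-sums) (InSpan-∑ A⊆WA))))
    (InSpan-cong (λ _ → *-comm SA SB) (InSpan-*ˡ SA (InSpan-∘ rem (InSpan-cong (proj₂ B-sums) (InSpan-∑ B⊆WB)))))

  ∑A₀≢0 : ∑ (suc m) (A zero) ≢ 0ℤ
  ∑A₀≢0 rewrite proj₁ A-sums zero = λ ()

  ∑B₀≢0 : ∑ (suc n) (B zero) ≢ 0ℤ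
  ∑B₀≢0 rewrite proj₁ B-sums zero = λ ()

  C-rank : ∀ {rA rB} → HasRank A rA → HasRank B rB → HasRank C (rA +ℕ rB ∸ 1)
  C-rank {zero}        (_ , maximalA) _ = ⊥-elim (maximalA (const zero) (sumNonzero⇒LinIndep ∑A₀≢0))
  C-rank {suc _} {zero} _ (_ , maximalB) = ⊥-elim (maximalB (const zero) (sumNonzero⇒LinIndep ∑B₀≢0))
  C-rank {suc a} {suc b} ((selA , indA) , maximalA) ((selB , indB) , maximalB) =
    (rows , rows-LinIndep indA indB) , rows-dependent
    where
    open Selection selA selB
    rows-dependent : ∀ (sel : Fin (suc (a +ℕ suc b)) → Fin (suc m *ℕ suc n)) → ¬ LinIndep (C ∘ sel)
    rows-dependent sel indC =
      maximal⇒¬¬spanning {sel = selA} indA maximalA λ A⊆WA →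
      maximal⇒¬¬spanning {sel = selB} indB maximalB λ B⊆WB →
      spannedByDependent⇒¬LinIndep (liftedBases-Dependency A⊆WA B⊆WB) (C-row-InSpan A⊆WA B⊆WB ∘ sel) indC

module ISDA-LineSums where

  open LinearAlgebra using (LineSums; ∑-remove)
  open import Data.Nat using (zero; suc) renaming (_+_ to _+ℕ_)
  open import Data.Nat.Properties using (1+n≰n)
  open import Data.Fin using (Fin; zero; suc; toℕ; punchIn; punchOut)
  open import Data.Fin.Properties using (any?; toℕ-injective; punchOut-injective; injective⇒≤)
    renaming (_≟_ to _≟ᶠ_)
  open import Data.Integer using (ℤ; +_; +[1+_]; 1ℤ; _+_)
  open import Data.Integer.Properties using (+-injective)
  open import Data.Product using (∃; ∃₂; _,_; proj₁; proj₂)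
  open import Data.Sum using (_⊎_; inj₁; inj₂)
  open import Function using (_∘_)
  open import Function.Definitions using (Injective)
  open import Relation.Nullary using (yes; no)
  open import Relation.Nullary.Negation using (contradiction)
  open import Relation.Binary.PropositionalEquality

  injective⇒surjective : ∀ {N} {f : Fin N → Fin N} → Injective _≡_ _≡_ f → ∀ j → ∃ λ v → f v ≡ j
  injective⇒surjective {suc N} {f} f-inj j with any? (λ v → f v ≟ᶠ j)
  ... | yes hit  = hit
  ... | no  miss = contradiction (injective⇒≤ g-inj) 1+n≰n
    where
    j≢f : ∀ v → j ≢ f v
    j≢f v j≡fv = miss (v , sym j≡fv)
    g : Fin (suc N) → Fin N
    g v = punchOut (j≢f v)
    g-inj : Injective _≡_ _≡_ g
    g-inj {v} {v′} gv≡gv′ = f-inj (punchOut-injective (j≢f v) (j≢f v′) gv≡gv′)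

  Natural : ∀ {N} → (Fin N → ℤ) → Set
  Natural f = ∀ j → ∃ λ k → f j ≡ + k

  permutation⇒Natural : ∀ {N} {f : Fin N → ℤ} → (∀ (v : Fin N) → ExactlyOnce f (+ toℕ v)) → Natural f
  permutation⇒Natural {f = f} once j with injective⇒surjective position-injective j
    where
    position : Fin _ → Fin _
    position v = proj₁ (once v)
    position-injective : Injective _≡_ _≡_ position
    position-injective {v} {v′} eq = toℕ-injective (+-injective
      (trans (sym (proj₁ (proj₂ (once v)))) (trans (cong f eq) (proj₁ (proj₂ (once v′))))))
  ... | v , refl = toℕ v , proj₁ (proj₂ (once v))

  ∑-Natural : ∀ N {f : Fin N → ℤ} → Natural f → ∃ λ k → ∑ N f ≡ + k
  ∑-Natural zero    nat = 0 , refl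
  ∑-Natural (suc N) nat with nat zero | ∑-Natural N (nat ∘ suc)
  ... | k₀ , e₀ | k , e = k₀ +ℕ k , cong₂ _+_ e₀ e

  ∑-positive : ∀ N {f : Fin (suc N) → ℤ} → Natural f → ∀ j₀ → f j₀ ≡ 1ℤ → ∃ λ s → ∑ (suc N) f ≡ +[1+ s ]
  ∑-positive N {f} nat j₀ fj₀≡1 with ∑-Natural N (nat ∘ punchIn j₀)
  ... | k , e = k , trans (∑-remove N j₀ f) (cong₂ _+_ fj₀≡1 e)

  positiveLineSums : ∀ {N} {M : Mat (suc N) (suc N)} → EqualLineSums (suc N) M →
    (∀ i → Natural (M i)) → (∃₂ λ i₀ j₀ → M i₀ j₀ ≡ 1ℤ) → ∃ λ s → LineSums (suc N) M +[1+ s ]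
  positiveLineSums {N} (s , rowSums , colSums) nat (i₀ , j₀ , M₀≡1) with ∑-positive N (nat i₀) j₀ M₀≡1
  ... | s′ , e = s′ , (λ i → trans (rowSums i) s≡) , (λ j → trans (colSums j) s≡)
    where s≡ : s ≡ +[1+ s′ ]
          s≡ = trans (sym (rowSums i₀)) e

  ISDA⇒positiveLineSums : ∀ {k N} {M : Mat (suc (suc N)) (suc (suc N))} → k ≡ 1 ⊎ k ≡ 2 →
    ISDA k (suc (suc N)) M → ∃ λ s → LineSums (suc (suc N)) M +[1+ s ]
  ISDA⇒positiveLineSums (inj₁ refl) (sums , rowsOnce , _) =
    positiveLineSums sums (permutation⇒Natural ∘ rowsOnce)
      (zero , proj₁ (rowsOnce zero (suc zero)) , proj₁ (proj₂ (rowsOnce zero (suc zero))))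
  ISDA⇒positiveLineSums (inj₂ refl) (sums , valuesOnce , entries) with valuesOnce (suc zero)
  ... | (i₀ , j₀) , M₀≡1 , _ =
    positiveLineSums sums (λ i j → toℕ (proj₁ (entries i j)) , proj₂ (entries i j)) (i₀ , j₀ , M₀≡1)

open ISDA-LineSums using (ISDA⇒positiveLineSums)
open LinearAlgebra using (HasRank-cong)
open import Data.Nat using (ℕ; suc; pred; _+_; _∸_; _^_; _≥_; s≤s; z≤n)
open import Data.Nat.Properties using (suc-pred; m^n≢0)
import Data.Integer as ℤ
open import Data.Integer using (+_)
open import Data.Integer.Properties using (*-identityˡ; *-identityʳ; *-comm)
open import Data.Sum using (_⊎_)
open import Data.Product using (_×_; _,_)
open import Relation.Binary.PropositionalEquality using (_≡_; refl; cong; cong₂; sym)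

suc-pred-^ : ∀ N k → suc (pred (suc N ^ k)) ≡ suc N ^ k
suc-pred-^ N k = suc-pred (suc N ^ k) {{m^n≢0 (suc N) k}}

mainTheorem4 : (k m n : ℕ) → (k ≡ 1 ⊎ k ≡ 2) → m ≥ 2 → n ≥ 2 →
    (A : Mat m m) → (B : Mat n n) → ISDA k m A → ISDA k n B →
    (rA rB : ℕ) → HasRank A rA → HasRank B rB →
    HasRank (((+ (n ^ k)) · (A ⊗ E n)) ⊕ (E m ⊗ B)) (rA + rB ∸ 1)
    × HasRank ((A ⊗ E n) ⊕ ((+ (m ^ k)) · (E m ⊗ B))) (rA + rB ∸ 1)
mainTheorem4 k (suc (suc m)) (suc (suc n)) k∈12 (s≤s (s≤s z≤n)) (s≤s (s≤s z≤n)) A B isdaA isdaB rA rB rankA rankB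
  with ISDA⇒positiveLineSums k∈12 isdaA | ISDA⇒positiveLineSums k∈12 isdaB
... | _ , A-sums | _ , B-sums =
  HasRank-cong Cᴬ-entries (Cᴬ.C-rank rankA rankB) , HasRank-cong Cᴰ-entries (Cᴰ.C-rank rankA rankB)
  where
  module Cᴬ = KroneckerSumRank A B A-sums B-sums (pred (suc (suc n) ^ k)) 0
  module Cᴰ = KroneckerSumRank A B A-sums B-sums 0 (pred (suc (suc m) ^ k))

  Cᴬ-entries : ∀ p q →
    Cᴬ.C p q ≡ (((+ (suc (suc n) ^ k)) · (A ⊗ E (suc (suc n)))) ⊕ (E (suc (suc m)) ⊗ B)) p q
  Cᴬ-entries p q = cong₂ ℤ._+_
    (cong₂ ℤ._*_ (cong +_ (suc-pred-^ (suc n) k)) (sym (*-identityʳ (A (Cᴬ.quot p) (Cᴬ.quot q)))))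
    refl

  Cᴰ-entries : ∀ p q →
    Cᴰ.C p q ≡ ((A ⊗ E (suc (suc n))) ⊕ ((+ (suc (suc m) ^ k)) · (E (suc (suc m)) ⊗ B))) p q
  Cᴰ-entries p q = cong₂ ℤ._+_
    (*-comm Cᴰ.X (A (Cᴰ.quot p) (Cᴰ.quot q)))
    (cong₂ ℤ._*_ (cong +_ (suc-pred-^ (suc m) k)) (sym (*-identityˡ (B (Cᴰ.rem p) (Cᴰ.rem q)))))
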